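{- Assume the reconstruction conjecture is true. Then for all finite undirected graphs $G$ and $H$ with $G\not\cong H$, there is a sentence $\varphi$ of monadic second-order logic (in the signature of one binary edge relation) using at most $3$ second-order (monadic) variables and at most $2$ first-order variables such that $G\models\varphi$ and $H\not\models\varphi$.
   Context: Graphs are finite, undirected, without multiple edges (loops allowed); an undirected edge is regarded as an edge in both directions. For a vertex $u$ of $G$, $G\setminus\{u\}$ is the induced subgraph on the remaining vertices. Reconstruction conjecture: if $G$ and $H$ are non-isomorphic (undirected) graphs, at least one having at least three vertices, then there is a graph $F$ such that the number of vertices $u$ of $G$ with $G\setminus\{u\}\cong F$ differs from the number of vertices $v$ of $H$ with $H\setminus\{v\}\cong F$. In a sentence "using at most $3$ second-order and at most $2$ first-order variables", variable symbols may be reused (requantified); only the number of distinct variable symbols is bounded. -}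

module Defs where

open import Data.Nat using (ℕ; zero; suc; _≤_)
open import Data.Bool using (Bool; true)
open import Data.Fin using (Fin; punchIn)
open import Data.Fin.Subset using (Subset; _∈_; ∣_∣; ⊥)
open import Data.Maybe using (Maybe; just; nothing)
open import Data.Product using (Σ; _×_; ∃-syntax)
open import Data.Sum using (_⊎_)
open import Data.Empty renaming (⊥ to Empty)
open import Relation.Nullary using (¬_)
open import Relation.Binary.PropositionalEquality using (_≡_; _≢_)
open import Function.Bundles using (_↔_; _⇔_; Inverse)

-- Finite undirected graphs (loops allowed, no multiple edges) on the
-- vertex set Fin n: a symmetric Boolean adjacency relation.

record Graph (n : ℕ) : Set where
  field
    adj : Fin n → Fin n → Bool
    adj-sym : ∀ i j → adj i j ≡ adj j i
open Graph public

_≅_ : {n m : ℕ} → Graph n → Graph m → Set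
_≅_ {n} {m} G H =
  Σ (Fin n ↔ Fin m) λ f →
    ∀ i j → adj G i j ≡ adj H (Inverse.to f i) (Inverse.to f j)

delete : {k : ℕ} → Graph (suc k) → Fin (suc k) → Graph k
delete G u = record
  { adj = λ i j → adj G (punchIn u i) (punchIn u j)
  ; adj-sym = λ i j → adj-sym G (punchIn u i) (punchIn u j)
  }

DeletedIso : {n k : ℕ} → Graph n → Fin n → Graph k → Set
DeletedIso {suc n} G u F = delete G u ≅ F

Represents : {n : ℕ} → Subset n → (Fin n → Set) → Set
Represents {n} S P = (u : Fin n) → (u ∈ S) ⇔ P u

DeckCountsDiffer : {n m k : ℕ} → Graph n → Graph m → Graph k → Set
DeckCountsDiffer G H F =
  ∃[ S ] ∃[ T ] (Represents S (λ u → DeletedIso G u F)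
               × Represents T (λ v → DeletedIso H v F)
               × ∣ S ∣ ≢ ∣ T ∣)

ReconstructionConjecture : Set
ReconstructionConjecture =
  {n m : ℕ} (G : Graph n) (H : Graph m) → ¬ (G ≅ H) → (3 ≤ n ⊎ 3 ≤ m) →
  ∃[ k ] Σ (Graph k) λ F → DeckCountsDiffer G H F

-- Monadic second-order logic over one binary relation E, with
-- first-order variable symbols Fin f and second-order (monadic)
-- variable symbols Fin s.  Variables may be requantified.

data MSO (f s : ℕ) : Set where
  edge  : Fin f → Fin f → MSO f s
  equal : Fin f → Fin f → MSO f s
  mem   : Fin f → Fin s → MSO f s
  neg   : MSO f s → MSO f s
  and   : MSO f s → MSO f s → MSO f s
  or    : MSO f s → MSO f s → MSO f s
  ex1   : Fin f → MSO f s → MSO f s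
  all1  : Fin f → MSO f s → MSO f s
  ex2   : Fin s → MSO f s → MSO f s
  all2  : Fin s → MSO f s → MSO f s

FreeFO : {f s : ℕ} → Fin f → MSO f s → Set
FreeFO x (edge y z)  = (x ≡ y) ⊎ (x ≡ z)
FreeFO x (equal y z) = (x ≡ y) ⊎ (x ≡ z)
FreeFO x (mem y X)   = x ≡ y
FreeFO x (neg φ)     = FreeFO x φ
FreeFO x (and φ ψ)   = FreeFO x φ ⊎ FreeFO x ψ
FreeFO x (or φ ψ)    = FreeFO x φ ⊎ FreeFO x ψ
FreeFO x (ex1 y φ)   = (x ≢ y) × FreeFO x φ
FreeFO x (all1 y φ)  = (x ≢ y) × FreeFO x φ
FreeFO x (ex2 Y φ)   = FreeFO x φ
FreeFO x (all2 Y φ)  = FreeFO x φ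

FreeSO : {f s : ℕ} → Fin s → MSO f s → Set
FreeSO X (edge y z)  = Empty
FreeSO X (equal y z) = Empty
FreeSO X (mem y Y)   = X ≡ Y
FreeSO X (neg φ)     = FreeSO X φ
FreeSO X (and φ ψ)   = FreeSO X φ ⊎ FreeSO X ψ
FreeSO X (or φ ψ)    = FreeSO X φ ⊎ FreeSO X ψ
FreeSO X (ex1 y φ)   = FreeSO X φ
FreeSO X (all1 y φ)  = FreeSO X φ
FreeSO X (ex2 Y φ)   = (X ≢ Y) × FreeSO X φ
FreeSO X (all2 Y φ)  = (X ≢ Y) × FreeSO X φ

IsSentence : {f s : ℕ} → MSO f s → Set
IsSentence {f} {s} φ = ((x : Fin f) → ¬ FreeFO x φ) × ((X : Fin s) → ¬ FreeSO X φ)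

upd : {A : Set} {k : ℕ} → (Fin k → A) → Fin k → A → Fin k → A
upd ρ x a y with Data.Fin._≟_ x y
... | Relation.Nullary.yes _ = a
... | Relation.Nullary.no  _ = ρ y

-- Semantics; first-order assignments are partial (Maybe) so that the
-- empty graph is handled; unassigned variables make atoms false
-- (irrelevant for sentences).
Sat : {n f s : ℕ} → Graph n → (Fin f → Maybe (Fin n)) → (Fin s → Subset n) →
      MSO f s → Set
Sat G ρ σ (edge x y) with ρ x | ρ y
... | just u | just v = adj G u v ≡ true
... | _      | _      = Empty
Sat G ρ σ (equal x y) with ρ x | ρ y
... | just u | just v = u ≡ v
... | _      | _      = Empty
Sat G ρ σ (mem x X) with ρ x
... | just u  = u ∈ σ X
... | nothing = Empty
Sat G ρ σ (neg φ)    = ¬ Sat G ρ σ φ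
Sat G ρ σ (and φ ψ)  = Sat G ρ σ φ × Sat G ρ σ ψ
Sat G ρ σ (or φ ψ)   = Sat G ρ σ φ ⊎ Sat G ρ σ ψ
Sat G ρ σ (ex1 x φ)  = ∃[ u ] Sat G (upd ρ x (just u)) σ φ
Sat G ρ σ (all1 x φ) = ∀ u → Sat G (upd ρ x (just u)) σ φ
Sat G ρ σ (ex2 X φ)  = ∃[ S ] Sat G ρ (upd σ X S) φ
Sat G ρ σ (all2 X φ) = ∀ S → Sat G ρ (upd σ X S) φ

_⊨_ : {n f s : ℕ} → Graph n → MSO f s → Set
G ⊨ φ = Sat G (λ _ → nothing) (λ _ → ⊥) φ

-- By induction on the order of A we build, for non-isomorphic graphs A and B and every set
-- variable X, a formula that holds whenever X induces a copy of A and fails whenever X induces a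
-- copy of B. Everything is done by counting, which needs only two first-order variables: X has at
-- least a + 1 elements iff some x ∈ X leaves at least a elements in X ∖ {x}, and "at least a
-- elements of X satisfy ψ" says that some subset of those elements has at least a elements.
-- Graphs of different orders are separated by counting the elements of X, graphs on at most two
-- vertices by counting their loops and the vertices with a neighbour. For larger graphs the
-- reconstruction conjecture provides a card F occurring a different number of times in the two
-- decks; by induction, the conjunction of formulas separating F from each card not isomorphic to
-- it recognises F among all these cards, so counting the x ∈ X for which X ∖ {x} is recognised as
-- F separates A from B. Taking X to be the whole vertex set gives the sentence.

module Submission where

open import Defs
open import Data.Nat using (ℕ; zero; suc; _≤_; z≤n; s≤s)
import Data.Nat as ℕ
open import Data.Nat.Properties using (<-cmp; <⇒≱) renaming (suc-injective to ℕ-suc-injective)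
open import Relation.Binary.Definitions using (tri<; tri≈; tri>)
open import Data.Bool using (Bool; true; false)
open import Data.Empty using (⊥-elim)
open import Data.Fin using (Fin; zero; suc; punchIn; punchOut; opposite)
open import Data.Fin.Properties
  using (_≟_; any?; injective⇒≤; suc-injective; 0≢1+n; punchIn-injective; punchInᵢ≢i; punchIn-punchOut;
         opposite-involutive)
open import Data.Fin.Subset using (Subset; _∈_; _∉_; _-_; ∣_∣; inside; outside; ⁅_⁆; ⊤; ⊥)
open import Data.Fin.Subset.Properties
  using (x∈p∧x≢y⇒x∈p-y; p─q⊆p; ⊆-antisym; _∈?_; ∈⊤; ∣⊤∣≡n)
open import Data.Vec using ([]; _∷_; tabulate; here; there)
open import Data.Vec.Properties using (lookup∘tabulate; []=⇒lookup; lookup⇒[]=)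
open import Data.Maybe using (Maybe; just)
open import Data.Sum using (_⊎_; inj₁; inj₂)
open import Data.Product using (Σ; _×_; _,_; proj₁; proj₂; ∃-syntax)
open import Function.Base using (id; _∘_)
open import Function.Bundles using (_⇔_; mk⇔; module Equivalence; Inverse; mk↔ₛ′)
open import Function.Construct.Identity using (↔-id)
open import Function.Definitions using (Injective)
import Function.Properties.Equivalence as ⇔
open import Function.Related.Propositional using (module EquationalReasoning; equivalence)
open import Relation.Nullary using (¬_; Dec; yes; no; does; ¬?; _×-dec_)
open import Relation.Nullary.Decidable as Dec using (dec-true)
open import Relation.Binary.PropositionalEquality
  using (_≡_; _≢_; refl; sym; trans; cong; cong₂; subst; module ≡-Reasoning)

open Equivalence using (to; from)

private variable
  a k m n s : ℕ

upd-same : {A : Set} (ρ : Fin k → A) (x : Fin k) (v : A) → upd ρ x v x ≡ v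
upd-same ρ x v with x ≟ x
... | yes _  = refl
... | no x≢x = ⊥-elim (x≢x refl)

upd-other : {A : Set} (ρ : Fin k → A) {x y : Fin k} (v : A) → x ≢ y → upd ρ x v y ≡ ρ y
upd-other ρ {x} {y} v x≢y with x ≟ y
... | yes x≡y = ⊥-elim (x≢y x≡y)
... | no _    = refl

∈-tabulate : {f : Fin n → Bool} {x : Fin n} → x ∈ tabulate f ⇔ f x ≡ true
∈-tabulate {f = f} {x} = mk⇔
  (λ x∈ → trans (sym (lookup∘tabulate f x)) ([]=⇒lookup x∈))
  (λ fx → lookup⇒[]= x _ (trans (lookup∘tabulate f x) fx))

image : (Fin a → Fin n) → Subset n
image f = tabulate λ y → does (any? λ t → f t ≟ y)

∈-image : {f : Fin a → Fin n} {y : Fin n} → y ∈ image f ⇔ (∃[ t ] f t ≡ y)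
∈-image {f = f} {y} = mk⇔ (witness (any? λ t → f t ≟ y) ∘ to ∈-tabulate)
                          (from ∈-tabulate ∘ dec-true (any? λ t → f t ≟ y))
  where
  witness : {A : Set} (A? : Dec A) → does A? ≡ true → A
  witness (yes x) _ = x

x∉p-x : (p : Subset n) (x : Fin n) → x ∉ p - x
x∉p-x (_ ∷ p) (suc x) (there x∈) = x∉p-x p x x∈

∈-remove : {p : Subset n} {x y : Fin n} → x ∈ p - y ⇔ (x ∈ p × x ≢ y)
∈-remove {p = p} {x} {y} = mk⇔
  (λ x∈ → p─q⊆p p ⁅ y ⁆ x∈ , λ { refl → x∉p-x p x x∈ })
  (λ (x∈p , x≢y) → x∈p∧x≢y⇒x∈p-y x∈p x≢y)

rank : (p : Subset n) {x : Fin n} → x ∈ p → Fin ∣ p ∣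
rank (inside  ∷ p) here       = zero
rank (inside  ∷ p) (there x∈) = suc (rank p x∈)
rank (outside ∷ p) (there x∈) = rank p x∈

rank-injective : (p : Subset n) {x y : Fin n} (x∈ : x ∈ p) (y∈ : y ∈ p) →
                 rank p x∈ ≡ rank p y∈ → x ≡ y
rank-injective (inside  ∷ p) here       here       _  = refl
rank-injective (inside  ∷ p) (there x∈) (there y∈) eq = cong suc (rank-injective p x∈ y∈ (suc-injective eq))
rank-injective (outside ∷ p) (there x∈) (there y∈) eq = cong suc (rank-injective p x∈ y∈ eq)

record AtLeast (a : ℕ) (P : Fin n → Set) : Set where
  field
    pick           : Fin a → Fin n
    pick-injective : Injective _≡_ _≡_ pick
    picked         : ∀ t → P (pick t)
open AtLeast

module _ {P : Fin n → Set} where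

  atLeast-zero : AtLeast 0 P
  atLeast-zero = record { pick = λ () ; pick-injective = λ {} ; picked = λ () }

  atLeast-suc⁺ : {x : Fin n} → P x → AtLeast a (λ y → P y × y ≢ x) → AtLeast (suc a) P
  atLeast-suc⁺ {x = x} Px rest = record
    { pick           = pick′
    ; pick-injective = injective
    ; picked         = λ { zero → Px ; (suc t) → proj₁ (picked rest t) }
    }
    where
    pick′ : Fin (suc _) → Fin n
    pick′ zero    = x
    pick′ (suc t) = pick rest t
    injective : Injective _≡_ _≡_ pick′
    injective {zero}  {zero}  _  = refl
    injective {zero}  {suc t} eq = ⊥-elim (proj₂ (picked rest t) (sym eq))
    injective {suc t} {zero}  eq = ⊥-elim (proj₂ (picked rest t) eq)
    injective {suc t} {suc u} eq = cong suc (pick-injective rest eq)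

  atLeast-suc⁻ : AtLeast (suc a) P → ∃[ x ] P x × AtLeast a (λ y → P y × y ≢ x)
  atLeast-suc⁻ at = pick at zero , picked at zero , record
    { pick           = pick at ∘ suc
    ; pick-injective = suc-injective ∘ pick-injective at
    ; picked         = λ t → picked at (suc t) , λ eq → 0≢1+n (pick-injective at (sym eq))
    }

  atLeast-map : (g : Fin n → Fin m) {R : Fin m → Set} → Injective _≡_ _≡_ g →
                (∀ {x} → P x → R (g x)) → AtLeast a P → AtLeast a R
  atLeast-map g g-injective P⇒R at = record
    { pick           = g ∘ pick at
    ; pick-injective = pick-injective at ∘ g-injective
    ; picked         = P⇒R ∘ picked at
    }

atLeast-preimage : {P : Fin m → Set} {Q : Fin n → Set} (g : Fin m → Fin n) →
                   (∀ {y} → Q y → ∃[ x ] P x × g x ≡ y) → AtLeast a Q → AtLeast a P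
atLeast-preimage {P = P} g lift at = record
  { pick           = proj₁ ∘ chosen
  ; pick-injective = λ {t} {u} eq → pick-injective at (begin
      pick at t               ≡⟨ proj₂ (proj₂ (chosen t)) ⟨
      g (proj₁ (chosen t))    ≡⟨ cong g eq ⟩
      g (proj₁ (chosen u))    ≡⟨ proj₂ (proj₂ (chosen u)) ⟩
      pick at u               ∎)
  ; picked         = proj₁ ∘ proj₂ ∘ chosen
  }
  where
  open ≡-Reasoning
  chosen : ∀ t → ∃[ x ] P x × g x ≡ pick at t
  chosen t = lift (picked at t)

atLeast-image : (f : Fin a → Fin n) → Injective _≡_ _≡_ f → AtLeast a (_∈ image f)
atLeast-image f f-injective = record
  { pick = f ; pick-injective = f-injective ; picked = λ t → from ∈-image (t , refl) }

atLeast-∣∣ : (p : Subset n) → AtLeast ∣ p ∣ (_∈ p)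
atLeast-∣∣ []            = atLeast-zero
atLeast-∣∣ (inside  ∷ p) =
  atLeast-suc⁺ here (atLeast-map suc suc-injective (λ x∈ → there x∈ , λ ()) (atLeast-∣∣ p))
atLeast-∣∣ (outside ∷ p) = atLeast-map suc suc-injective there (atLeast-∣∣ p)

atLeast⇒≤∣∣ : {p : Subset n} → AtLeast a (_∈ p) → a ≤ ∣ p ∣
atLeast⇒≤∣∣ {p = p} at =
  injective⇒≤ (λ eq → pick-injective at (rank-injective p (picked at _) (picked at _) eq))

atLeast-suc-∈ : {p : Subset n} → AtLeast (suc a) (_∈ p) ⇔ (∃[ x ] x ∈ p × AtLeast a (_∈ p - x))
atLeast-suc-∈ = mk⇔
  (λ at → let (x , x∈ , rest) = atLeast-suc⁻ at in
          x , x∈ , atLeast-map id id (from ∈-remove) rest)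
  (λ (x , x∈ , rest) → atLeast-suc⁺ x∈ (atLeast-map id id (to ∈-remove) rest))

-- Induced subgraphs

record _≅_[_] (A : Graph k) (G : Graph n) (Y : Subset n) : Set where
  field
    embed           : Fin k → Fin n
    embed-injective : Injective _≡_ _≡_ embed
    embed-∈         : ∀ u → embed u ∈ Y
    embed-onto      : ∀ {y} → y ∈ Y → ∃[ u ] embed u ≡ y
    embed-adj       : ∀ u v → adj A u v ≡ adj G (embed u) (embed v)
open _≅_[_]

module _ {A : Graph k} {G : Graph n} where

  ≅[]-cast : {Y Z : Subset n} → Y ≡ Z → A ≅ G [ Y ] → A ≅ G [ Z ]
  ≅[]-cast Y≡Z e = record
    { embed           = embed e
    ; embed-injective = embed-injective e
    ; embed-∈         = λ u → subst (embed e u ∈_) Y≡Z (embed-∈ e u)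
    ; embed-onto      = λ y∈ → embed-onto e (subst (_ ∈_) (sym Y≡Z) y∈)
    ; embed-adj       = embed-adj e
    }

  ≅[]-transport : {B : Graph m} {Y : Subset n} → A ≅ B → A ≅ G [ Y ] → B ≅ G [ Y ]
  ≅[]-transport {B = B} (f , adj-f) e = record
    { embed           = embed e ∘ from′
    ; embed-injective = λ eq → begin
        _                ≡⟨ strictlyInverseˡ _ ⟨
        to′ (from′ _)    ≡⟨ cong to′ (embed-injective e eq) ⟩
        to′ (from′ _)    ≡⟨ strictlyInverseˡ _ ⟩
        _                ∎
    ; embed-∈         = embed-∈ e ∘ from′
    ; embed-onto      = λ y∈ → let (u , eu≡y) = embed-onto e y∈ in
                         to′ u , trans (cong (embed e) (strictlyInverseʳ u)) eu≡y
    ; embed-adj       = λ u v → begin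
        adj B u v                            ≡⟨ cong₂ (adj B) (strictlyInverseˡ u) (strictlyInverseˡ v) ⟨
        adj B (to′ (from′ u)) (to′ (from′ v)) ≡⟨ adj-f (from′ u) (from′ v) ⟨
        adj A (from′ u) (from′ v)            ≡⟨ embed-adj e (from′ u) (from′ v) ⟩
        adj G (embed e (from′ u)) (embed e (from′ v)) ∎
    }
    where
    open ≡-Reasoning
    open Inverse f using (strictlyInverseˡ; strictlyInverseʳ) renaming (to to to′; from to from′)

module _ {A : Graph (suc k)} {G : Graph n} {Y : Subset n} where

  ≅[]-delete : (e : A ≅ G [ Y ]) (u : Fin (suc k)) → delete A u ≅ G [ Y - embed e u ]
  ≅[]-delete e u = record
    { embed           = embed e ∘ punchIn u
    ; embed-injective = punchIn-injective u _ _ ∘ embed-injective e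
    ; embed-∈         = λ v → from ∈-remove (embed-∈ e _ , punchInᵢ≢i u v ∘ embed-injective e)
    ; embed-onto      = λ y∈ → let (y∈Y , y≢eu) = to ∈-remove y∈
                                   (w , ew≡y) = embed-onto e y∈Y
                                   u≢w = λ u≡w → y≢eu (trans (sym ew≡y) (cong (embed e) (sym u≡w)))
                               in punchOut u≢w , trans (cong (embed e) (punchIn-punchOut u≢w)) ew≡y
    ; embed-adj       = λ v w → embed-adj e (punchIn u v) (punchIn u w)
    }

≅[]-whole : (G : Graph n) {Y : Subset n} → (∀ y → y ∈ Y) → G ≅ G [ Y ]
≅[]-whole G all∈ = record
  { embed           = id
  ; embed-injective = id
  ; embed-∈         = all∈
  ; embed-onto      = λ {y} _ → y , refl
  ; embed-adj       = λ _ _ → refl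
  }

-- Counting formulas

x₀ x₁ : Fin 2
x₀ = zero
x₁ = suc zero

tt : MSO 2 s
tt = all1 x₀ (equal x₀ x₀)

_⇒_ : MSO 2 s → MSO 2 s → MSO 2 s
φ ⇒ ψ = or (neg φ) ψ

⇒-intro : {A B : Set} → Dec A → (A → B) → ¬ A ⊎ B
⇒-intro (yes a) a⇒b = inj₂ (a⇒b a)
⇒-intro (no ¬a) _   = inj₁ ¬a

⇒-elim : {A B : Set} → ¬ A ⊎ B → A → B
⇒-elim (inj₁ ¬a) a = ⊥-elim (¬a a)
⇒-elim (inj₂ b)  _ = b

⋀ : (Fin k → MSO 2 s) → MSO 2 s
⋀ {zero}  φs = tt
⋀ {suc k} φs = and (φs zero) (⋀ (φs ∘ suc))

⋀-sat : {G : Graph n} {ρ : Fin 2 → Maybe (Fin n)} {σ : Fin s → Subset n} (φs : Fin k → MSO 2 s) →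
        Sat G ρ σ (⋀ φs) ⇔ (∀ u → Sat G ρ σ (φs u))
⋀-sat {k = zero}  φs = mk⇔ (λ _ ()) (λ _ _ → refl)
⋀-sat {k = suc k} φs = mk⇔
  (λ { (head , rest) → λ { zero → head ; (suc u) → to (⋀-sat (φs ∘ suc)) rest u } })
  (λ all → all zero , from (⋀-sat (φs ∘ suc)) (all ∘ suc))

isMinus : Fin s → Fin s → MSO 2 s
isMinus Y X = all1 x₁ (and (mem x₁ Y ⇒ rest) (rest ⇒ mem x₁ Y))
  where
  rest : MSO 2 _
  rest = and (mem x₁ X) (neg (equal x₁ x₀))

letMinus : Fin s → Fin s → MSO 2 s → MSO 2 s
letMinus Y X φ = ex2 Y (and (isMinus Y X) φ)

module _ {G : Graph n} {ρ : Fin 2 → Maybe (Fin n)} {v : Fin n} where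

  isMinus-sat : (σ : Fin s → Subset n) {X Y : Fin s} →
                Sat G (upd ρ x₀ (just v)) σ (isMinus Y X) ⇔ σ Y ≡ σ X - v
  isMinus-sat σ {X} {Y} = mk⇔
    (λ sat → ⊆-antisym (λ {z} z∈ → from ∈-remove (⇒-elim (proj₁ (sat z)) z∈))
                       (λ {z} z∈ → ⇒-elim (proj₂ (sat z)) (to ∈-remove z∈)))
    (λ eq z → ⇒-intro (z ∈? σ Y) (λ z∈ → to ∈-remove (subst (z ∈_) eq z∈))
            , ⇒-intro (z ∈? σ X ×-dec ¬? (z ≟ v))
                      (λ z∈ → subst (z ∈_) (sym eq) (from ∈-remove z∈)))

  letMinus-sat : {σ : Fin s → Subset n} {X Y : Fin s} {φ : MSO 2 s} → Y ≢ X →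
                 Sat G (upd ρ x₀ (just v)) σ (letMinus Y X φ) ⇔
                 Sat G (upd ρ x₀ (just v)) (upd σ Y (σ X - v)) φ
  letMinus-sat {σ = σ} {X} {Y} {φ} Y≢X = mk⇔
    (λ (W , W-is-minus , sat) →
       subst (λ W → Sat G _ (upd σ Y W) φ) (minus≡ W (to (isMinus-sat (upd σ Y W)) W-is-minus)) sat)
    (λ sat → σ X - v , from (isMinus-sat (upd σ Y (σ X - v))) (minus≡⁻¹ (σ X - v) refl) , sat)
    where
    minus≡ : ∀ W → upd σ Y W Y ≡ upd σ Y W X - v → W ≡ σ X - v
    minus≡ W eq = trans (sym (upd-same σ Y W)) (trans eq (cong (_- v) (upd-other σ W Y≢X)))
    minus≡⁻¹ : ∀ W → W ≡ σ X - v → upd σ Y W Y ≡ upd σ Y W X - v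
    minus≡⁻¹ W eq = trans (upd-same σ Y W) (trans eq (sym (cong (_- v) (upd-other σ W Y≢X))))

sizeAtLeast : ℕ → Fin s → Fin s → MSO 2 s
sizeAtLeast zero    X Y = tt
sizeAtLeast (suc a) X Y = ex1 x₀ (and (mem x₀ X) (letMinus Y X (sizeAtLeast a Y X)))

sizeAtLeast-sat : {G : Graph n} {ρ : Fin 2 → Maybe (Fin n)} {σ : Fin s → Subset n} {X Y : Fin s} →
                  (a : ℕ) → X ≢ Y → Sat G ρ σ (sizeAtLeast a X Y) ⇔ AtLeast a (_∈ σ X)
sizeAtLeast-sat zero    _   = mk⇔ (λ _ → atLeast-zero) (λ _ _ → refl)
sizeAtLeast-sat {G = G} {ρ} {σ} {X} {Y} (suc a) X≢Y = mk⇔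
  (λ (v , v∈ , rest) → from atLeast-suc-∈ (v , v∈ , to (removing v) rest))
  (λ at → let (v , v∈ , rest) = to atLeast-suc-∈ at in v , v∈ , from (removing v) rest)
  where
  open EquationalReasoning {k = equivalence}
  removing : ∀ v → Sat G (upd ρ x₀ (just v)) σ (letMinus Y X (sizeAtLeast a Y X)) ⇔
                   AtLeast a (_∈ σ X - v)
  removing v = begin
    Sat G (upd ρ x₀ (just v)) σ (letMinus Y X (sizeAtLeast a Y X))
      ∼⟨ letMinus-sat {φ = sizeAtLeast a Y X} (X≢Y ∘ sym) ⟩
    Sat G (upd ρ x₀ (just v)) (upd σ Y (σ X - v)) (sizeAtLeast a Y X)
      ∼⟨ sizeAtLeast-sat a (X≢Y ∘ sym) ⟩
    AtLeast a (_∈ upd σ Y (σ X - v) Y)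
      ≡⟨ cong (λ p → AtLeast a (_∈ p)) (upd-same σ Y _) ⟩
    AtLeast a (_∈ σ X - v)
      ∎

record Defines (X : Fin s) (ψ : MSO 2 s) (A : Graph k) (P : Fin k → Set) : Set where
  field
    defines : ∀ {n} {G : Graph n} {ρ : Fin 2 → Maybe (Fin n)} {σ : Fin s → Subset n} →
              (e : A ≅ G [ σ X ]) (u : Fin k) → Sat G (upd ρ x₀ (just (embed e u))) σ ψ ⇔ P u
open Defines

countAtLeast : ℕ → Fin s → Fin s → MSO 2 s → MSO 2 s
countAtLeast a X Y ψ = ex2 Y (and (all1 x₀ (mem x₀ Y ⇒ and (mem x₀ X) ψ)) (sizeAtLeast a Y X))

countAtLeast-sat : {A : Graph k} {P : Fin k → Set} {ψ : MSO 2 s} {X Y : Fin s} →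
  Y ≢ X → Defines X ψ A P →
  {G : Graph n} {ρ : Fin 2 → Maybe (Fin n)} {σ : Fin s → Subset n} → A ≅ G [ σ X ] →
  (a : ℕ) → Sat G ρ σ (countAtLeast a X Y ψ) ⇔ AtLeast a P
countAtLeast-sat {A = A} {P} {ψ} {X} {Y} Y≢X ψ-defines {G} {ρ} {σ} e a = mk⇔ counted complete
  where
  σ[Y≔_] : Subset _ → Fin _ → Subset _
  σ[Y≔ Z ] = upd σ Y Z
  e′ : ∀ Z → A ≅ G [ σ[Y≔ Z ] X ]
  e′ Z = ≅[]-cast (sym (upd-other σ Z Y≢X)) e
  size-sat : ∀ Z → Sat G ρ σ[Y≔ Z ] (sizeAtLeast a Y X) ⇔ AtLeast a (_∈ Z)
  size-sat Z = subst (λ p → Sat G ρ σ[Y≔ Z ] (sizeAtLeast a Y X) ⇔ AtLeast a (_∈ p))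
                     (upd-same σ Y Z) (sizeAtLeast-sat a Y≢X)

  counted : Sat G ρ σ (countAtLeast a X Y ψ) → AtLeast a P
  counted (Z , selects , size) = atLeast-preimage (embed e) lift (to (size-sat Z) size)
    where
    lift : ∀ {y} → y ∈ Z → ∃[ u ] P u × embed e u ≡ y
    lift {y} y∈Z with ⇒-elim (selects y) (subst (y ∈_) (sym (upd-same σ Y Z)) y∈Z)
    ... | y∈X , ψ-holds with embed-onto (e′ Z) y∈X
    ...   | u , refl = u , to (defines ψ-defines (e′ Z) u) ψ-holds , refl

  complete : AtLeast a P → Sat G ρ σ (countAtLeast a X Y ψ)
  complete at = image f , (λ y → ⇒-intro (y ∈? _) (select ∘ subst (y ∈_) (upd-same σ Y (image f))))
                        , from (size-sat (image f)) (atLeast-image f (pick-injective at ∘ embed-injective e))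
    where
    f : Fin a → Fin _
    f = embed e ∘ pick at
    select : ∀ {y} → y ∈ image f →
             y ∈ σ[Y≔ image f ] X × Sat G (upd ρ x₀ (just y)) σ[Y≔ image f ] ψ
    select y∈ with to (∈-image {f = f}) y∈
    ... | t , refl = embed-∈ (e′ _) (pick at t) , from (defines ψ-defines (e′ _) (pick at t)) (picked at t)

Defines-⇔ : {X : Fin s} {ψ : MSO 2 s} {A : Graph k} {P Q : Fin k → Set} →
            (∀ {u} → P u ⇔ Q u) → Defines X ψ A P → Defines X ψ A Q
Defines-⇔ P⇔Q ψ-defines = record { defines = λ e u → ⇔.trans (defines ψ-defines e u) P⇔Q }

-- Separators

record Separator (X : Fin s) (A : Graph k) (B : Graph m) : Set where
  field
    formula : MSO 2 s
    accepts : ∀ {n} {G : Graph n} {ρ σ} → A ≅ G [ σ X ] → Sat G ρ σ formula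
    rejects : ∀ {n} {G : Graph n} {ρ σ} → B ≅ G [ σ X ] → ¬ Sat G ρ σ formula
open Separator

swap : {X : Fin s} {A : Graph k} {B : Graph m} → Separator X A B → Separator X B A
swap sep = record
  { formula = neg (formula sep)
  ; accepts = rejects sep
  ; rejects = λ e ¬sat → ¬sat (accepts sep e)
  }

byCount : {X Y : Fin s} {A : Graph k} {B : Graph m} {ψ : MSO 2 s} {P : Fin k → Set} {Q : Fin m → Set} →
          Y ≢ X → Defines X ψ A P → Defines X ψ B Q → AtLeast a P → ¬ AtLeast a Q → Separator X A B
byCount {a = a} {X} {Y} {ψ = ψ} Y≢X ψ-defines-P ψ-defines-Q at-P ¬at-Q = record
  { formula = countAtLeast a X Y ψ
  ; accepts = λ e → from (countAtLeast-sat Y≢X ψ-defines-P e a) at-P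
  ; rejects = λ e → ¬at-Q ∘ to (countAtLeast-sat Y≢X ψ-defines-Q e a)
  }

bySubsets : {X Y : Fin s} {A : Graph k} {B : Graph m} {ψ : MSO 2 s} {p : Subset k} {q : Subset m} →
            Y ≢ X → Defines X ψ A (_∈ p) → Defines X ψ B (_∈ q) → ∣ p ∣ ≢ ∣ q ∣ →
            Separator X A B
bySubsets {p = p} {q} Y≢X ψ-defines-p ψ-defines-q ∣p∣≢∣q∣ with <-cmp ∣ p ∣ ∣ q ∣
... | tri< ∣p∣<∣q∣ _ _ =
  swap (byCount Y≢X ψ-defines-q ψ-defines-p (atLeast-∣∣ q) (<⇒≱ ∣p∣<∣q∣ ∘ atLeast⇒≤∣∣))
... | tri≈ _ ∣p∣≡∣q∣ _ = ⊥-elim (∣p∣≢∣q∣ ∣p∣≡∣q∣)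
... | tri> _ _ ∣q∣<∣p∣ =
  byCount Y≢X ψ-defines-p ψ-defines-q (atLeast-∣∣ p) (<⇒≱ ∣q∣<∣p∣ ∘ atLeast⇒≤∣∣)

tt-defines : {X : Fin s} {A : Graph k} → Defines X tt A (_∈ ⊤)
tt-defines = record { defines = λ _ _ → mk⇔ (λ _ → ∈⊤) (λ _ _ → refl) }

bySize : {X Y : Fin s} {A : Graph k} {B : Graph m} → Y ≢ X → k ≢ m → Separator X A B
bySize {k = k} {m} Y≢X k≢m =
  bySubsets Y≢X tt-defines tt-defines (λ eq → k≢m (trans (sym (∣⊤∣≡n k)) (trans eq (∣⊤∣≡n m))))

-- Graphs on at most two vertices

loops : Graph k → Subset k
loops A = tabulate λ u → adj A u u

loop : MSO 2 s
loop = edge x₀ x₀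

loop-defines : {X : Fin s} {A : Graph k} → Defines X loop A (_∈ loops A)
loop-defines = record { defines = λ e u → mk⇔
  (λ loop-at-eu → from ∈-tabulate (trans (embed-adj e u u) loop-at-eu))
  (λ u∈ → trans (sym (embed-adj e u u)) (to ∈-tabulate u∈)) }

HasNeighbour : Graph k → Fin k → Set
HasNeighbour A u = ∃[ v ] v ≢ u × adj A u v ≡ true

hasNeighbourIn : Fin s → MSO 2 s
hasNeighbourIn X = ex1 x₁ (and (mem x₁ X) (and (neg (equal x₁ x₀)) (edge x₀ x₁)))

hasNeighbourIn-defines : {X : Fin s} {A : Graph k} → Defines X (hasNeighbourIn X) A (HasNeighbour A)
hasNeighbourIn-defines {X = X} {A} = record { defines = λ {σ = σ} e u →
  mk⇔ (neighbour {σ = σ} e u)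
      (λ (v , v≢u , uv) → embed e v , embed-∈ e v , v≢u ∘ embed-injective e , trans (sym (embed-adj e u v)) uv) }
  where
  neighbour : ∀ {n} {G : Graph n} {σ : Fin _ → Subset n} (e : A ≅ G [ σ X ]) u →
              (∃[ y ] y ∈ σ X × y ≢ embed e u × adj G (embed e u) y ≡ true) → HasNeighbour A u
  neighbour e u (y , y∈ , y≢eu , euy) with embed-onto e y∈
  ... | v , refl = v , (λ v≡u → y≢eu (cong (embed e) v≡u)) , trans (embed-adj e u v) euy

one-bit : ∀ b c → ∣ b ∷ [] ∣ ≡ ∣ c ∷ [] ∣ → b ≡ c
one-bit false false _ = refl
one-bit true  true  _ = refl
one-bit false true  ()
one-bit true  false ()

two-bits : ∀ b₀ b₁ c₀ c₁ → ∣ b₀ ∷ b₁ ∷ [] ∣ ≡ ∣ c₀ ∷ c₁ ∷ [] ∣ →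
           (b₀ ≡ c₀ × b₁ ≡ c₁) ⊎ (b₀ ≡ c₁ × b₁ ≡ c₀)
two-bits true  b₁    true  c₁    eq = inj₁ (refl , one-bit b₁ c₁ (ℕ-suc-injective eq))
two-bits false b₁    false c₁    eq = inj₁ (refl , one-bit b₁ c₁ eq)
two-bits true  false false true  _  = inj₂ (refl , refl)
two-bits false true  true  false _  = inj₂ (refl , refl)
two-bits true  true  false true  ()
two-bits true  true  false false ()
two-bits true  false false false ()
two-bits false true  true  true  ()
two-bits false false true  _     ()

graph₁-≅ : {A B : Graph 1} → ∣ loops A ∣ ≡ ∣ loops B ∣ → A ≅ B
graph₁-≅ {A} {B} eq = ↔-id _ , λ { zero zero → one-bit _ _ eq }

neighbours₂ : Graph 2 → Subset 2
neighbours₂ A = tabulate λ u → adj A u (opposite u)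

∈-neighbours₂ : {A : Graph 2} {u : Fin 2} → u ∈ neighbours₂ A ⇔ HasNeighbour A u
∈-neighbours₂ {A} {u} = mk⇔
  (λ u∈ → opposite u , opposite≢ u , to (∈-tabulate {f = λ u → adj A u (opposite u)}) u∈)
  (λ (v , v≢u , uv) → from (∈-tabulate {f = λ u → adj A u (opposite u)})
                             (subst (λ v → adj A u v ≡ true) (≢⇒opposite v≢u) uv))
  where
  opposite≢ : (u : Fin 2) → opposite u ≢ u
  opposite≢ zero       ()
  opposite≢ (suc zero) ()
  ≢⇒opposite : {u v : Fin 2} → v ≢ u → v ≡ opposite u
  ≢⇒opposite {zero}     {zero}     v≢u = ⊥-elim (v≢u refl)
  ≢⇒opposite {zero}     {suc zero} _   = refl
  ≢⇒opposite {suc zero} {zero}     _   = refl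
  ≢⇒opposite {suc zero} {suc zero} v≢u = ⊥-elim (v≢u refl)

adjacency₂ : {A B : Graph 2} (π : Fin 2 → Fin 2) →
             adj A zero zero ≡ adj B (π zero) (π zero) →
             adj A (suc zero) (suc zero) ≡ adj B (π (suc zero)) (π (suc zero)) →
             adj A zero (suc zero) ≡ adj B (π zero) (π (suc zero)) →
             ∀ u v → adj A u v ≡ adj B (π u) (π v)
adjacency₂         π loop₀ loop₁ edge≡ zero       zero       = loop₀
adjacency₂         π loop₀ loop₁ edge≡ zero       (suc zero) = edge≡
adjacency₂ {A} {B} π loop₀ loop₁ edge≡ (suc zero) zero       =
  trans (adj-sym A _ _) (trans edge≡ (adj-sym B _ _))
adjacency₂         π loop₀ loop₁ edge≡ (suc zero) (suc zero) = loop₁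

graph₂-≅ : {A B : Graph 2} → ∣ loops A ∣ ≡ ∣ loops B ∣ → ∣ neighbours₂ A ∣ ≡ ∣ neighbours₂ B ∣ →
           A ≅ B
graph₂-≅ {A} {B} loops≡ neighbours≡ = matching-loops (two-bits _ _ _ _ loops≡)
  where
  edge≡ : adj A zero (suc zero) ≡ adj B zero (suc zero)
  edge≡ with two-bits (adj A zero (suc zero)) (adj A (suc zero) zero)
                     (adj B zero (suc zero)) (adj B (suc zero) zero) neighbours≡
  ... | inj₁ (e , _) = e
  ... | inj₂ (e , _) = trans e (adj-sym B (suc zero) zero)
  matching-loops :
    (adj A zero zero ≡ adj B zero zero × adj A (suc zero) (suc zero) ≡ adj B (suc zero) (suc zero)) ⊎
    (adj A zero zero ≡ adj B (suc zero) (suc zero) × adj A (suc zero) (suc zero) ≡ adj B zero zero) →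
    A ≅ B
  matching-loops (inj₁ (loop₀ , loop₁)) = ↔-id _ , adjacency₂ {A} {B} id loop₀ loop₁ edge≡
  matching-loops (inj₂ (loop₀ , loop₁)) =
    mk↔ₛ′ opposite opposite opposite-involutive opposite-involutive ,
    adjacency₂ {A} {B} opposite loop₀ loop₁ (trans edge≡ (adj-sym B zero (suc zero)))

graph₀-≅ : {A B : Graph 0} → A ≅ B
graph₀-≅ = ↔-id _ , λ ()

separator₁ : {X Y : Fin s} → Y ≢ X → (A B : Graph 1) → ¬ A ≅ B → Separator X A B
separator₁ Y≢X A B A≇B =
  bySubsets Y≢X (loop-defines {A = A}) (loop-defines {A = B}) (A≇B ∘ graph₁-≅ {A} {B})

separator₂ : {X Y : Fin s} → Y ≢ X → (A B : Graph 2) → ¬ A ≅ B → Separator X A B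
separator₂ Y≢X A B A≇B with ∣ loops A ∣ ℕ.≟ ∣ loops B ∣
... | no  loops≢ = bySubsets Y≢X (loop-defines {A = A}) (loop-defines {A = B}) loops≢
... | yes loops≡ =
  bySubsets Y≢X (neighbours-defines A) (neighbours-defines B) (A≇B ∘ graph₂-≅ {A} {B} loops≡)
  where
  neighbours-defines : (C : Graph 2) → Defines _ _ C (_∈ neighbours₂ C)
  neighbours-defines C = Defines-⇔ (⇔.sym (∈-neighbours₂ {C})) (hasNeighbourIn-defines {A = C})

-- Decks

record CardTest (Y : Fin s) (F : Graph k) (C : Graph m) : Set where
  field
    test   : MSO 2 s
    passes : ∀ {n} {G : Graph n} {ρ σ} → F ≅ G [ σ Y ] → Sat G ρ σ test
    sound  : ∀ {n} {G : Graph n} {ρ σ} → C ≅ G [ σ Y ] → Sat G ρ σ test → C ≅ F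
open CardTest

cardTest : {Y : Fin s} {F : Graph k} {C : Graph m} →
           Dec (C ≅ F) → (¬ C ≅ F → Separator Y C F) → CardTest Y F C
cardTest (yes C≅F) _ = record { test = tt ; passes = λ _ _ → refl ; sound = λ _ _ → C≅F }
cardTest {F = F} {C} (no C≇F) separate = record
  { test = formula sep ; passes = accepts sep ; sound = λ e → ⊥-elim ∘ rejects sep e }
  where
  sep : Separator _ F C
  sep = swap (separate C≇F)

-- Y holds X ∖ {x} for the card test and is also the counting register of byCount; this is harmless
-- because every formula is specified only through the register it talks about.
module Deck {X Y : Fin s} (Y≢X : Y ≢ X)
            {F : Graph k} (separate : (C : Graph m) → ¬ C ≅ F → Separator Y C F)
            {A B : Graph (suc m)} {p q : Subset (suc m)}
            (p-represents : Represents p (λ u → DeletedIso A u F))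
            (q-represents : Represents q (λ u → DeletedIso B u F)) where

  IsoCards : Graph (suc m) → Subset (suc m) → Set
  IsoCards D r = Represents r (λ u → DeletedIso D u F)

  cardTests : (D : Graph (suc m)) {r : Subset (suc m)} → IsoCards D r →
              (u : Fin (suc m)) → CardTest Y F (delete D u)
  cardTests D r-represents u = cardTest (Dec.map (r-represents u) (u ∈? _)) (separate _)

  bothTests : Fin (suc m) → MSO 2 s
  bothTests u = and (test (cardTests A p-represents u)) (test (cardTests B q-represents u))

  isCard : MSO 2 s
  isCard = ⋀ bothTests

  isCard-sat : (D : Graph (suc m)) {r : Subset (suc m)} (r-represents : IsoCards D r) →
    (∀ u {n} {G : Graph n} {ρ σ} → Sat G ρ σ isCard → Sat G ρ σ (test (cardTests D r-represents u))) →
    ∀ u {n} {G : Graph n} {ρ σ} → delete D u ≅ G [ σ Y ] → Sat G ρ σ isCard ⇔ (u ∈ r)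
  isCard-sat D r-represents isCard⇒test u e = mk⇔
    (from (r-represents u) ∘ sound (cardTests D r-represents u) e ∘ isCard⇒test u)
    (λ u∈r → let F-at-Y = ≅[]-transport (to (r-represents u) u∈r) e in
             from (⋀-sat bothTests) λ v →
               passes (cardTests A p-represents v) F-at-Y , passes (cardTests B q-represents v) F-at-Y)

  deckCount-defines : (D : Graph (suc m)) {r : Subset (suc m)} (r-represents : IsoCards D r) →
    (∀ u {n} {G : Graph n} {ρ σ} → Sat G ρ σ isCard → Sat G ρ σ (test (cardTests D r-represents u))) →
    Defines X (letMinus Y X isCard) D (_∈ r)
  deckCount-defines D r-represents isCard⇒test = record { defines = λ {σ = σ} e u →
    ⇔.trans (letMinus-sat {φ = isCard} Y≢X)
      (isCard-sat D r-represents isCard⇒test u (≅[]-cast (sym (upd-same σ Y _)) (≅[]-delete e u))) }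

  byCardCounts : ∣ p ∣ ≢ ∣ q ∣ → Separator X A B
  byCardCounts = bySubsets Y≢X
    (deckCount-defines A p-represents λ u sat → proj₁ (to (⋀-sat bothTests) sat u))
    (deckCount-defines B q-represents λ u sat → proj₂ (to (⋀-sat bothTests) sat u))

byDeck : {X Y : Fin s} {F : Graph k} {A B : Graph (suc m)} → Y ≢ X →
         ((C : Graph m) → ¬ C ≅ F → Separator Y C F) → DeckCountsDiffer A B F → Separator X A B
byDeck Y≢X separate (_ , _ , p-represents , q-represents , ∣p∣≢∣q∣) =
  Deck.byCardCounts Y≢X separate p-represents q-represents ∣p∣≢∣q∣

next : Fin 3 → Fin 3
next zero             = suc zero
next (suc zero)       = suc (suc zero)
next (suc (suc zero)) = zero

next≢ : (X : Fin 3) → next X ≢ X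
next≢ zero             ()
next≢ (suc zero)       ()
next≢ (suc (suc zero)) ()

mutual
  separator : ReconstructionConjecture → (X : Fin 3) (k : ℕ) (A : Graph k) (B : Graph m) →
              ¬ A ≅ B → Separator X A B
  separator {m} rc X k A B A≇B with k ℕ.≟ m
  separator {m}  rc X k A B A≇B | no  k≢m  = bySize (next≢ X) k≢m
  separator {.k} rc X k A B A≇B | yes refl = separator-sameSize rc X k A B A≇B

  separator-sameSize : ReconstructionConjecture → (X : Fin 3) (k : ℕ) (A B : Graph k) →
                       ¬ A ≅ B → Separator X A B
  separator-sameSize rc X 0 A B A≇B = ⊥-elim (A≇B (graph₀-≅ {A} {B}))
  separator-sameSize rc X 1 = separator₁ (next≢ X)
  separator-sameSize rc X 2 A B = separator₂ (next≢ X) A B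
  separator-sameSize rc X (suc (suc (suc k))) A B A≇B =
    let (_ , F , decks-differ) = rc A B A≇B (inj₁ (s≤s (s≤s (s≤s z≤n)))) in
    byDeck (next≢ X) (λ C C≇F → separator rc (next X) (suc (suc k)) C F C≇F) decks-differ

X₀ : Fin 3
X₀ = zero

-- Separators are specified for every assignment, so their formulas may be closed universally.
onWholeGraph : MSO 2 3 → MSO 2 3
onWholeGraph φ =
  ex2 X₀ (and (all1 x₀ (mem x₀ X₀)) (all1 x₀ (all1 x₁ (all2 (suc zero) (all2 (suc (suc zero)) φ)))))

onWholeGraph-sentence : (φ : MSO 2 3) → IsSentence (onWholeGraph φ)
onWholeGraph-sentence φ = no-free-FO , no-free-SO
  where
  no-free-FO : (x : Fin 2) → ¬ FreeFO x (onWholeGraph φ)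
  no-free-FO x          (inj₁ (x≢x₀ , x≡x₀))  = x≢x₀ x≡x₀
  no-free-FO zero       (inj₂ (x≢x₀ , _))     = x≢x₀ refl
  no-free-FO (suc zero) (inj₂ (_ , x≢x₁ , _)) = x≢x₁ refl
  no-free-SO : (X : Fin 3) → ¬ FreeSO X (onWholeGraph φ)
  no-free-SO X                (X≢X₀ , inj₁ X≡X₀)                = X≢X₀ X≡X₀
  no-free-SO zero             (X≢X₀ , inj₂ _)                   = X≢X₀ refl
  no-free-SO (suc zero)       (_ , inj₂ (X≢X₁ , _))             = X≢X₁ refl
  no-free-SO (suc (suc zero)) (_ , inj₂ (_ , X≢X₂ , _))         = X≢X₂ refl

module _ {G : Graph n} {H : Graph m} (sep : Separator X₀ G H) where

  onWholeGraph-accepts : G ⊨ onWholeGraph (formula sep)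
  onWholeGraph-accepts = ⊤ , (λ _ → ∈⊤) , λ _ _ _ _ → accepts sep (≅[]-whole G (λ _ → ∈⊤))

  onWholeGraph-rejects : Fin m → ¬ H ⊨ onWholeGraph (formula sep)
  onWholeGraph-rejects v (S , all∈S , sat) = rejects sep (≅[]-whole H all∈S) (sat v v ⊥ ⊥)

someVertex : MSO 2 3
someVertex = ex1 x₀ (equal x₀ x₀)

someVertex-sentence : IsSentence someVertex
someVertex-sentence =
  (λ { zero (x≢x₀ , _) → x≢x₀ refl ; (suc zero) (_ , inj₁ ()) ; (suc zero) (_ , inj₂ ()) }) , λ _ ()

corollary8p4 : ReconstructionConjecture →
    {n m : ℕ} (G : Graph n) (H : Graph m) → ¬ (G ≅ H) →
    Σ (MSO 2 3) λ φ → IsSentence φ × (G ⊨ φ) × ¬ (H ⊨ φ)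
corollary8p4 rc {n} {suc m} G H G≇H =
  onWholeGraph (formula sep) , onWholeGraph-sentence (formula sep) ,
  onWholeGraph-accepts sep , onWholeGraph-rejects sep zero
  where
  sep : Separator X₀ G H
  sep = separator rc X₀ n G H G≇H
-- The universal closure holds vacuously in the empty graph.
corollary8p4 rc {suc n} {zero} G H G≇H = someVertex , someVertex-sentence , (zero , refl) , λ ()
corollary8p4 rc {zero}  {zero} G H G≇H = ⊥-elim (G≇H (graph₀-≅ {G} {H}))
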